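{- Let $k\ge1$ and let $\bar P_{(k,k)}$ be the poset on $\{a_1,\dots,a_k,b_1,\dots,b_k\}$ generated by the cover relations $a_{j+1}\prec a_j$ for $1\le j\le k-1$ and $b_j\prec a_j$ for $1\le j\le k$ (the ladder poset $P_{(k,k)}$ with the relations among the $b_j$ removed). Then for all $n\ge0$, \[ \mathrm{ehr}(\mathcal{O}(\bar P_{(k,k)}),n)=S(n+k+1,n+1), \] where $S(r,s)$ is the Stirling number of the second kind.
   Context: For a finite poset $P$, the order polytope $\mathcal{O}(P)\subset\mathbb{R}^P$ is defined by $0\le x_s\le1$ and $x_s\le x_{s'}$ whenever $s\prec s'$; $\mathrm{ehr}(\mathcal{O}(P),n)=|n\mathcal{O}(P)\cap\mathbb{Z}^P|$ for $n\ge1$ and $=1$ for $n=0$ (it counts order-preserving maps $P\to\{0,\dots,n\}$). $S(r,s)$ is the number of partitions of an $r$-set into $s$ nonempty blocks. -}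

module Defs where

open import Data.Nat using (ℕ; zero; suc; _+_; _*_; _≤_; _≤?_)
open import Data.Fin using (Fin; toℕ)
open import Data.Sum using (_⊎_; inj₁; inj₂)
open import Data.Product using (_×_; _,_)
open import Data.List using (List; []; _∷_; map; concatMap; filter; length; allFin; cartesianProduct)
open import Data.Empty using (⊥)
open import Relation.Binary.PropositionalEquality using (_≡_)
open import Relation.Nullary using (Dec; yes; no)
open import Relation.Nullary.Decidable using (_×-dec_)
open import Relation.Unary using (Decidable)
open import Data.Vec using (Vec; lookup)
open import Data.Fin.Properties using (_≟_) renaming (all? to allFin?)
open import Relation.Nullary.Decidable using (map′; _→-dec_)

S : ℕ → ℕ → ℕ
S zero    zero    = 1
S zero    (suc s) = 0
S (suc r) zero    = 0
S (suc r) (suc s) = suc s * S r (suc s) + S r s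

-- Elements of the poset  P̄_(k,k):  inj₁ j = a_(j+1),  inj₂ j = b_(j+1)
-- (j : Fin k, so indices 1..k).
Elem : ℕ → Set
Elem k = Fin k ⊎ Fin k

-- The partial order generated by the covers a_(j+1) ≺ a_j and b_j ≺ a_j,
-- written out explicitly (this is its reflexive–transitive closure):
--   a_i ≼ a_j  iff  j ≤ i ;   b_i ≼ a_j  iff  j ≤ i ;
--   b_i ≼ b_j  iff  i = j ;   a_i ≼ b_j  never.
_≼_ : ∀ {k} → Elem k → Elem k → Set
inj₁ i ≼ inj₁ j = toℕ j ≤ toℕ i
inj₂ i ≼ inj₁ j = toℕ j ≤ toℕ i
inj₂ i ≼ inj₂ j = i ≡ j
inj₁ i ≼ inj₂ j = ⊥

elems : (k : ℕ) → List (Elem k)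
elems k = map inj₁ (allFin k) Data.List.++ map inj₂ (allFin k)

Map : ℕ → ℕ → Set
Map k n = Vec (Fin (suc n)) k × Vec (Fin (suc n)) k

app : ∀ {k n} → Map k n → Elem k → Fin (suc n)
app (f , g) (inj₁ i) = lookup f i
app (f , g) (inj₂ i) = lookup g i

OrderPreserving : ∀ {k n} → Map k n → Set
OrderPreserving {k} h = ∀ (x y : Elem k) → x ≼ y → toℕ (app h x) ≤ toℕ (app h y)

allVecs : (A : Set) → List A → (m : ℕ) → List (Vec A m)
allVecs A as zero    = Vec.[] ∷ []
allVecs A as (suc m) = concatMap (λ a → map (a Vec.∷_) (allVecs A as m)) as

allMaps : (k n : ℕ) → List (Map k n)
allMaps k n = cartesianProduct (allVecs (Fin (suc n)) (allFin (suc n)) k)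
                               (allVecs (Fin (suc n)) (allFin (suc n)) k)

_≼?_ : ∀ {k} (x y : Elem k) → Dec (x ≼ y)
inj₁ i ≼? inj₁ j = toℕ j ≤? toℕ i
inj₂ i ≼? inj₁ j = toℕ j ≤? toℕ i
inj₂ i ≼? inj₂ j = i ≟ j
inj₁ i ≼? inj₂ j = no (λ ())

allElem? : ∀ {k} {P : Elem k → Set} → (∀ x → Dec (P x)) → Dec (∀ x → P x)
allElem? P? with allFin? (λ i → P? (inj₁ i)) | allFin? (λ i → P? (inj₂ i))
... | yes p | yes q = yes λ { (inj₁ i) → p i ; (inj₂ i) → q i }
... | no ¬p | _     = no λ h → ¬p (λ i → h (inj₁ i))
... | yes _ | no ¬q = no λ h → ¬q (λ i → h (inj₂ i))

orderPreserving? : ∀ {k n} (h : Map k n) → Dec (OrderPreserving h)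
orderPreserving? h = allElem? λ x → allElem? λ y →
  (x ≼? y) →-dec (toℕ (app h x) ≤? toℕ (app h y))

-- ehr(O(P̄_(k,k)), n) = number of order-preserving maps P̄_(k,k) → {0,…,n}
ehrLadderBar : ℕ → ℕ → ℕ
ehrLadderBar k n = length (filter orderPreserving? (allMaps k n))

{-# OPTIONS --safe #-}
module Submission where

-- An order-preserving map P̄ → {0,…,n} is a chain n ≥ f(a₁) ≥ ⋯ ≥ f(aₖ) together with
-- independent values g(bⱼ) ≤ f(aⱼ), so their number is the sum over such chains of
-- ∏ⱼ (f(aⱼ) + 1). Writing W(m, c) (ladders m c) for this sum over chains of length m bounded
-- by c, splitting off the top value gives W(m+1, c) = Σ_{x ≤ c} (x+1) W(m, x). The Stirling
-- recurrence S(r+1, s+1) = (s+1) S(r, s+1) + S(r, s), unrolled in s, gives the same recursion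
-- for S(c+m+1, c+1), and both are 1 at m = 0.

open import Defs
open import Data.Nat.Properties
open import Algebra.Properties.CommutativeMonoid.Sum +-0-commutativeMonoid
  using (sum; sum-cong-≗; sum-init-last)
open import Data.Bool using (true; false; if_then_else_)
open import Data.Fin using (Fin; toℕ; zero; suc)
open import Data.Fin.Properties using (toℕ≤pred[n]; toℕ-inject₁; toℕ-fromℕ)
open import Data.List
  using (List; []; _∷_; _++_; map; concatMap; filter; length; tabulate; allFin; cartesianProduct)
open import Data.List.Properties using (filter-≐)
open import Data.Nat using (ℕ; zero; suc; _+_; _*_; _≤_; _<_; _≤?_; z≤n; s≤s)
open import Data.Product using (_×_; _,_; uncurry)
open import Data.Sum using (inj₁; inj₂)
open import Data.Unit using (⊤; tt)
open import Data.Vec using (Vec; []; _∷_; lookup)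
open import Function using (_∘_; id)
open import Relation.Binary.PropositionalEquality
open import Relation.Nullary using (Dec; yes; does; ¬_; _×-dec_)
open import Relation.Nullary.Decidable using (dec-true; dec-false)
open import Relation.Unary using (Decidable)
open ≡-Reasoning

𝟙 : {P : Set} → Dec P → ℕ
𝟙 P? = if does P? then 1 else 0

module _ {P : Set} (P? : Dec P) where

  𝟙-yes : P → 𝟙 P? ≡ 1
  𝟙-yes p rewrite dec-true P? p = refl

  𝟙-no : ¬ P → 𝟙 P? ≡ 0
  𝟙-no ¬p rewrite dec-false P? ¬p = refl

  𝟙-×-dec : {Q : Set} (Q? : Dec Q) → 𝟙 (P? ×-dec Q?) ≡ 𝟙 P? * 𝟙 Q?
  𝟙-×-dec Q? with does P?
  ... | true  = sym (+-identityʳ _)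
  ... | false = refl

private
  variable
    A B : Set

∑ : List A → (A → ℕ) → ℕ
∑ []       h = 0
∑ (x ∷ xs) h = h x + ∑ xs h

∑-cong : ∀ xs {h k : A → ℕ} → (∀ x → h x ≡ k x) → ∑ xs h ≡ ∑ xs k
∑-cong []       h≗k = refl
∑-cong (x ∷ xs) h≗k = cong₂ _+_ (h≗k x) (∑-cong xs h≗k)

∑-++ : ∀ xs ys (h : A → ℕ) → ∑ (xs ++ ys) h ≡ ∑ xs h + ∑ ys h
∑-++ []       ys h = refl
∑-++ (x ∷ xs) ys h = trans (cong (h x +_) (∑-++ xs ys h)) (sym (+-assoc (h x) _ _))

∑-*ˡ : ∀ xs c (h : A → ℕ) → ∑ xs (λ x → c * h x) ≡ c * ∑ xs h
∑-*ˡ []       c h = sym (*-zeroʳ c)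
∑-*ˡ (x ∷ xs) c h = trans (cong (c * h x +_) (∑-*ˡ xs c h)) (sym (*-distribˡ-+ c (h x) _))

∑-*ʳ : ∀ xs c (h : A → ℕ) → ∑ xs (λ x → h x * c) ≡ ∑ xs h * c
∑-*ʳ []       c h = refl
∑-*ʳ (x ∷ xs) c h = trans (cong (h x * c +_) (∑-*ʳ xs c h)) (sym (*-distribʳ-+ c (h x) _))

length-filter≡∑𝟙 : {P : A → Set} (P? : Decidable P) (xs : List A) → length (filter P? xs) ≡ ∑ xs (𝟙 ∘ P?)
length-filter≡∑𝟙 P? []       = refl
length-filter≡∑𝟙 P? (x ∷ xs) with does (P? x)
... | true  = cong suc (length-filter≡∑𝟙 P? xs)
... | false = length-filter≡∑𝟙 P? xs

∑-*-∑ : ∀ xs ys (u : A → ℕ) (v : B → ℕ) → ∑ xs (λ x → ∑ ys (λ y → u x * v y)) ≡ ∑ xs u * ∑ ys v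
∑-*-∑ xs ys u v = trans (∑-cong xs (λ x → ∑-*ˡ ys (u x) v)) (∑-*ʳ xs (∑ ys v) u)

∑-*ˡ² : ∀ xs c d (h : A → ℕ) → ∑ xs (λ x → c * (d * h x)) ≡ c * (d * ∑ xs h)
∑-*ˡ² xs c d h = trans (∑-*ˡ xs c (λ x → d * h x)) (cong (c *_) (∑-*ˡ xs d h))

∑-tabulate : ∀ N (f : Fin N → A) (h : A → ℕ) → ∑ (tabulate f) h ≡ sum (h ∘ f)
∑-tabulate zero    f h = refl
∑-tabulate (suc N) f h = cong (h (f zero) +_) (∑-tabulate N (f ∘ suc) h)

∑-map : ∀ (g : A → B) xs (h : B → ℕ) → ∑ (map g xs) h ≡ ∑ xs (h ∘ g)
∑-map g []       h = refl
∑-map g (x ∷ xs) h = cong (h (g x) +_) (∑-map g xs h)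

∑-concatMap : ∀ (f : A → List B) xs (h : B → ℕ) → ∑ (concatMap f xs) h ≡ ∑ xs (λ x → ∑ (f x) h)
∑-concatMap f []       h = refl
∑-concatMap f (x ∷ xs) h = trans (∑-++ (f x) _ h) (cong (∑ (f x) h +_) (∑-concatMap f xs h))

∑-cartesianProduct : ∀ xs ys (h : A × B → ℕ) →
  ∑ (cartesianProduct xs ys) h ≡ ∑ xs (λ x → ∑ ys (λ y → h (x , y)))
∑-cartesianProduct []       ys h = refl
∑-cartesianProduct (x ∷ xs) ys h =
  trans (∑-++ (map (x ,_) ys) _ h) (cong₂ _+_ (∑-map (x ,_) ys h) (∑-cartesianProduct xs ys h))

∑-allVecs-suc : ∀ as m (h : Vec A (suc m) → ℕ) →
  ∑ (allVecs A as (suc m)) h ≡ ∑ as (λ a → ∑ (allVecs A as m) (λ v → h (a ∷ v)))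
∑-allVecs-suc as m h =
  trans (∑-concatMap _ as h) (∑-cong as (λ a → ∑-map (a ∷_) (allVecs _ as m) h))

sum-const : ∀ N x → sum {N} (λ _ → x) ≡ N * x
sum-const zero    x = refl
sum-const (suc N) x = cong (x +_) (sum-const N x)

sum-toℕ-last : ∀ N (F : ℕ → ℕ) →
  sum (λ (i : Fin (suc N)) → F (toℕ i)) ≡ sum (λ (i : Fin N) → F (toℕ i)) + F N
sum-toℕ-last N F = trans (sum-init-last {N} (F ∘ toℕ))
  (cong₂ _+_ (sum-cong-≗ {N} (cong F ∘ toℕ-inject₁)) (cong F (toℕ-fromℕ N)))

sum-≤-truncate : ∀ {n c} (F : ℕ → ℕ) → c ≤ n →
  sum (λ (i : Fin (suc n)) → 𝟙 (toℕ i ≤? c) * F (toℕ i)) ≡ sum (λ (i : Fin (suc c)) → F (toℕ i))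
sum-≤-truncate {c = c} F c≤n with m≤n⇒m<n∨m≡n c≤n
... | inj₂ refl = sum-cong-≗ λ i →
  trans (cong (_* F (toℕ i)) (𝟙-yes (toℕ i ≤? c) (toℕ≤pred[n] i))) (*-identityˡ _)
... | inj₁ (s≤s {n = n} c≤n) = begin
  sum (λ (i : Fin (suc (suc n))) → G (toℕ i))  ≡⟨ sum-toℕ-last (suc n) G ⟩
  sum (λ (i : Fin (suc n)) → G (toℕ i)) + G (suc n)
    ≡⟨ cong (λ k → sum (λ (i : Fin (suc n)) → G (toℕ i)) + k * F (suc n))
            (𝟙-no (suc n ≤? c) (<⇒≱ (s≤s c≤n))) ⟩
  sum (λ (i : Fin (suc n)) → G (toℕ i)) + 0  ≡⟨ +-identityʳ _ ⟩
  sum (λ (i : Fin (suc n)) → G (toℕ i))      ≡⟨ sum-≤-truncate F c≤n ⟩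
  sum (λ (i : Fin (suc c)) → F (toℕ i))      ∎
  where
  G : ℕ → ℕ
  G x = 𝟙 (x ≤? c) * F x

∑-allFin-≤ : ∀ {n c} → c ≤ n → ∑ (allFin (suc n)) (λ i → 𝟙 (toℕ i ≤? c)) ≡ suc c
∑-allFin-≤ {n} {c} c≤n = begin
  ∑ (allFin (suc n)) (λ i → 𝟙 (toℕ i ≤? c))
    ≡⟨ ∑-tabulate (suc n) id (λ i → 𝟙 (toℕ i ≤? c)) ⟩
  sum {suc n} (λ i → 𝟙 (toℕ i ≤? c))
    ≡⟨ sum-cong-≗ {suc n} (λ i → sym (*-identityʳ (𝟙 (toℕ i ≤? c)))) ⟩
  sum {suc n} (λ i → 𝟙 (toℕ i ≤? c) * 1)
    ≡⟨ sum-≤-truncate (λ _ → 1) c≤n ⟩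
  sum {suc c} (λ _ → 1)
    ≡⟨ sum-const (suc c) 1 ⟩
  suc c * 1
    ≡⟨ *-identityʳ (suc c) ⟩
  suc c ∎

S-above-diagonal : ∀ {r s} → r < s → S r s ≡ 0
S-above-diagonal {zero}  {suc s} _ = refl
S-above-diagonal {suc r} {suc s} (s≤s r<s)
  rewrite S-above-diagonal (m<n⇒m<1+n r<s) | S-above-diagonal r<s =
    trans (+-identityʳ _) (*-zeroʳ (suc s))

S-diagonal : ∀ r → S r r ≡ 1
S-diagonal zero    = refl
S-diagonal (suc r) rewrite S-above-diagonal (n<1+n r) | S-diagonal r = cong (_+ 1) (*-zeroʳ (suc r))

S-telescoped : ∀ m c →
  sum (λ (i : Fin (suc c)) → suc (toℕ i) * S (suc (toℕ i + m)) (suc (toℕ i)))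
    ≡ S (suc (suc (c + m))) (suc c)
S-telescoped m zero    = refl
S-telescoped m (suc c) = begin
  sum (λ (i : Fin (suc (suc c))) → G (toℕ i))   ≡⟨ sum-toℕ-last (suc c) G ⟩
  sum (λ (i : Fin (suc c)) → G (toℕ i)) + G (suc c)
    ≡⟨ cong (_+ G (suc c)) (S-telescoped m c) ⟩
  S (suc (suc (c + m))) (suc c) + G (suc c)      ≡⟨ +-comm _ (G (suc c)) ⟩
  S (suc (suc (suc c + m))) (suc (suc c))        ∎
  where
  G : ℕ → ℕ
  G x = suc x * S (suc (x + m)) (suc x)

Ladder : ∀ {m n} → ℕ → Vec (Fin (suc n)) m → Vec (Fin (suc n)) m → Set
Ladder c []      []      = ⊤
Ladder c (a ∷ f) (b ∷ g) = toℕ a ≤ c × toℕ b ≤ toℕ a × Ladder (toℕ a) f g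

ladder? : ∀ {m n} c (f g : Vec (Fin (suc n)) m) → Dec (Ladder c f g)
ladder? c []      []      = yes tt
ladder? c (a ∷ f) (b ∷ g) = (toℕ a ≤? c) ×-dec (toℕ b ≤? toℕ a) ×-dec ladder? (toℕ a) f g

ladder-bounded : ∀ {m n c} {f g : Vec (Fin (suc n)) m} → Ladder c f g → ∀ i → toℕ (lookup f i) ≤ c
ladder-bounded {f = a ∷ f} {b ∷ g} (a≤c , _ , _) zero    = a≤c
ladder-bounded {f = a ∷ f} {b ∷ g} (a≤c , _ , L) (suc i) = ≤-trans (ladder-bounded L i) a≤c

ladder⇒orderPreserving : ∀ {m n c} {f g : Vec (Fin (suc n)) m} → Ladder c f g → OrderPreserving (f , g)
ladder⇒orderPreserving {f = []}    {[]}    _ (inj₁ ()) _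
ladder⇒orderPreserving {f = []}    {[]}    _ (inj₂ ()) _
ladder⇒orderPreserving {f = a ∷ f} {b ∷ g} (_ , b≤a , L) = op
  where
  op-tail : OrderPreserving (f , g)
  op-tail = ladder⇒orderPreserving L
  f≤a : ∀ i → toℕ (lookup f i) ≤ toℕ a
  f≤a = ladder-bounded L
  op : OrderPreserving (a ∷ f , b ∷ g)
  op (inj₁ zero)    (inj₁ zero)    _         = ≤-refl
  op (inj₁ (suc i)) (inj₁ zero)    _         = f≤a i
  op (inj₁ (suc i)) (inj₁ (suc j)) (s≤s j≤i) = op-tail (inj₁ i) (inj₁ j) j≤i
  op (inj₂ zero)    (inj₁ zero)    _         = b≤a
  op (inj₂ (suc i)) (inj₁ zero)    _         = ≤-trans (op-tail (inj₂ i) (inj₁ i) ≤-refl) (f≤a i)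
  op (inj₂ (suc i)) (inj₁ (suc j)) (s≤s j≤i) = op-tail (inj₂ i) (inj₁ j) j≤i
  op (inj₂ i)       (inj₂ .i)      refl      = ≤-refl

orderPreserving-tail : ∀ {m n} {a b} {f g : Vec (Fin (suc n)) m} →
  OrderPreserving (a ∷ f , b ∷ g) → OrderPreserving (f , g)
orderPreserving-tail op (inj₁ i) (inj₁ j) j≤i  = op (inj₁ (suc i)) (inj₁ (suc j)) (s≤s j≤i)
orderPreserving-tail op (inj₂ i) (inj₁ j) j≤i  = op (inj₂ (suc i)) (inj₁ (suc j)) (s≤s j≤i)
orderPreserving-tail op (inj₂ i) (inj₂ .i) refl = op (inj₂ (suc i)) (inj₂ (suc i)) refl

orderPreserving⇒ladder : ∀ {m n c} {f g : Vec (Fin (suc n)) m} →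
  (∀ i → toℕ (lookup f i) ≤ c) → OrderPreserving (f , g) → Ladder c f g
orderPreserving⇒ladder {f = []}    {[]}    _     _  = tt
orderPreserving⇒ladder {f = a ∷ f} {b ∷ g} f≤c op =
  f≤c zero ,
  op (inj₂ zero) (inj₁ zero) ≤-refl ,
  orderPreserving⇒ladder (λ i → op (inj₁ (suc i)) (inj₁ zero) z≤n) (orderPreserving-tail op)

-- [c ≥ f₁ ≥ f₂ ≥ ⋯] · ∏ᵢ (fᵢ + 1): given f, each gᵢ of a ladder ranges independently over 0 … fᵢ.
completions : ∀ {m n} → ℕ → Vec (Fin (suc n)) m → ℕ
completions c []      = 1
completions c (a ∷ f) = 𝟙 (toℕ a ≤? c) * (suc (toℕ a) * completions (toℕ a) f)

module _ (n : ℕ) where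

  vectors : (m : ℕ) → List (Vec (Fin (suc n)) m)
  vectors = allVecs (Fin (suc n)) (allFin (suc n))

  ∑-ladder≡completions : ∀ {m} c (f : Vec (Fin (suc n)) m) →
    ∑ (vectors m) (𝟙 ∘ ladder? c f) ≡ completions c f
  ∑-ladder≡completions c []              = refl
  ∑-ladder≡completions {suc m} c (a ∷ f) = begin
    ∑ (vectors (suc m)) (𝟙 ∘ ladder? c (a ∷ f))
      ≡⟨ ∑-allVecs-suc (allFin (suc n)) m _ ⟩
    ∑ (allFin (suc n)) (λ b → ∑ (vectors m) (λ g → 𝟙 (ladder? c (a ∷ f) (b ∷ g))))
      ≡⟨ ∑-cong (allFin (suc n)) (λ b → ∑-cong (vectors m) (𝟙-ladder-∷ b)) ⟩
    ∑ (allFin (suc n)) (λ b → ∑ (vectors m) (λ g → (a≤c * b≤a b) * 𝟙 (ladder? (toℕ a) f g)))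
      ≡⟨ ∑-*-∑ (allFin (suc n)) (vectors m) (λ b → a≤c * b≤a b) (𝟙 ∘ ladder? (toℕ a) f) ⟩
    ∑ (allFin (suc n)) (λ b → a≤c * b≤a b) * ∑ (vectors m) (𝟙 ∘ ladder? (toℕ a) f)
      ≡⟨ cong₂ _*_ (∑-*ˡ (allFin (suc n)) a≤c b≤a) (∑-ladder≡completions (toℕ a) f) ⟩
    a≤c * ∑ (allFin (suc n)) b≤a * completions (toℕ a) f
      ≡⟨ cong (λ k → a≤c * k * completions (toℕ a) f) (∑-allFin-≤ (toℕ≤pred[n] a)) ⟩
    a≤c * suc (toℕ a) * completions (toℕ a) f
      ≡⟨ *-assoc a≤c (suc (toℕ a)) _ ⟩
    a≤c * (suc (toℕ a) * completions (toℕ a) f) ∎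
    where
    a≤c : ℕ
    a≤c = 𝟙 (toℕ a ≤? c)
    b≤a : Fin (suc n) → ℕ
    b≤a b = 𝟙 (toℕ b ≤? toℕ a)
    𝟙-ladder-∷ : ∀ b g → 𝟙 (ladder? c (a ∷ f) (b ∷ g)) ≡ (a≤c * b≤a b) * 𝟙 (ladder? (toℕ a) f g)
    𝟙-ladder-∷ b g = begin
      𝟙 (ladder? c (a ∷ f) (b ∷ g))
        ≡⟨ 𝟙-×-dec (toℕ a ≤? c) ((toℕ b ≤? toℕ a) ×-dec ladder? (toℕ a) f g) ⟩
      a≤c * 𝟙 ((toℕ b ≤? toℕ a) ×-dec ladder? (toℕ a) f g)
        ≡⟨ cong (a≤c *_) (𝟙-×-dec (toℕ b ≤? toℕ a) (ladder? (toℕ a) f g)) ⟩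
      a≤c * (b≤a b * 𝟙 (ladder? (toℕ a) f g))
        ≡⟨ *-assoc a≤c (b≤a b) _ ⟨
      (a≤c * b≤a b) * 𝟙 (ladder? (toℕ a) f g) ∎

  ladders : ℕ → ℕ → ℕ
  ladders m c = ∑ (vectors m) (completions c)

  ladders≡S : ∀ m c → c ≤ n → ladders m c ≡ S (suc (c + m)) (suc c)
  ladders≡S zero    c _   =
    sym (trans (cong (λ r → S (suc r) (suc c)) (+-identityʳ c)) (S-diagonal (suc c)))
  ladders≡S (suc m) c c≤n = begin
    ladders (suc m) c
      ≡⟨ ∑-allVecs-suc (allFin (suc n)) m (completions c) ⟩
    ∑ (allFin (suc n)) (λ a →
      ∑ (vectors m) (λ f → 𝟙 (toℕ a ≤? c) * (suc (toℕ a) * completions (toℕ a) f)))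
      ≡⟨ ∑-cong (allFin (suc n)) (λ a → ∑-*ˡ² (vectors m) (𝟙 (toℕ a ≤? c)) (suc (toℕ a)) _) ⟩
    ∑ (allFin (suc n)) (λ a → 𝟙 (toℕ a ≤? c) * (suc (toℕ a) * ladders m (toℕ a)))
      ≡⟨ ∑-cong (allFin (suc n)) (λ a → cong (λ w → 𝟙 (toℕ a ≤? c) * (suc (toℕ a) * w))
                                              (ladders≡S m (toℕ a) (toℕ≤pred[n] a))) ⟩
    ∑ (allFin (suc n)) (λ a → 𝟙 (toℕ a ≤? c) * G (toℕ a))
      ≡⟨ ∑-tabulate (suc n) id (λ a → 𝟙 (toℕ a ≤? c) * G (toℕ a)) ⟩
    sum (λ (a : Fin (suc n)) → 𝟙 (toℕ a ≤? c) * G (toℕ a))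
      ≡⟨ sum-≤-truncate G c≤n ⟩
    sum (λ (a : Fin (suc c)) → G (toℕ a))
      ≡⟨ S-telescoped m c ⟩
    S (suc (suc (c + m))) (suc c)
      ≡⟨ cong (λ r → S (suc r) (suc c)) (+-suc c m) ⟨
    S (suc (c + suc m)) (suc c) ∎
    where
    G : ℕ → ℕ
    G x = suc x * S (suc (x + m)) (suc x)

theorem6p1 : (k : ℕ) → 1 ≤ k → (n : ℕ) → ehrLadderBar k n ≡ S (n + k + 1) (n + 1)
theorem6p1 k _ n = begin
  length (filter orderPreserving? (allMaps k n))
    ≡⟨ cong length (filter-≐ orderPreserving? (uncurry (ladder? n))
                             (op⇒ladder , ladder⇒orderPreserving) (allMaps k n)) ⟩
  length (filter (uncurry (ladder? n)) (allMaps k n))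
    ≡⟨ length-filter≡∑𝟙 (uncurry (ladder? n)) (allMaps k n) ⟩
  ∑ (allMaps k n) (𝟙 ∘ uncurry (ladder? n))
    ≡⟨ ∑-cartesianProduct (vectors n k) (vectors n k) _ ⟩
  ∑ (vectors n k) (λ f → ∑ (vectors n k) (𝟙 ∘ ladder? n f))
    ≡⟨ ∑-cong (vectors n k) (∑-ladder≡completions n n) ⟩
  ladders n k n
    ≡⟨ ladders≡S n k n ≤-refl ⟩
  S (suc (n + k)) (suc n)
    ≡⟨ cong₂ S (+-comm 1 (n + k)) (+-comm 1 n) ⟩
  S (n + k + 1) (n + 1) ∎
  where
  op⇒ladder : ∀ {h : Map k n} → OrderPreserving h → uncurry (Ladder n) h
  op⇒ladder {f , g} = orderPreserving⇒ladder (toℕ≤pred[n] ∘ lookup f)
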